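{- Let $G$ be an $R$-thin graph of order $n\geq 3$ having no connected component isomorphic to $K_2$. Then $D'(\mu(G))\leq D'(G)+1$.
   Context: Graphs are finite, simple and undirected. A graph is $R$-thin if no two distinct vertices have the same open neighborhood. For a graph $G$ with vertices $v_1,\dots,v_n$, the Mycielski graph $\mu(G)$ has vertex set $\{v_1,\dots,v_n,u_1,\dots,u_n,w\}$ and edge set consisting of the edges of $G$, the edges $wu_i$ for all $i$, and for every edge $v_iv_j$ of $G$ the two edges $u_iv_j$ and $v_iu_j$. An edge labeling $\psi:E(H)\to\{1,\dots,d\}$ is distinguishing if the only automorphism of $H$ preserving all edge labels is the identity; the distinguishing index $D'(H)$ (defined for graphs with no $K_2$ component) is the least such $d$. -}

module Defs where

open import Data.Nat using (ℕ; suc; _<_)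
open import Data.Fin using (Fin)
open import Data.Bool using (Bool; true; false)
open import Data.Product using (Σ; _×_; ∃)
open import Data.Empty using (⊥)
open import Relation.Nullary using (¬_)
open import Relation.Binary.PropositionalEquality using (_≡_)

record Graph (V : Set) : Set where
  field
    adj    : V → V → Bool
    sym    : ∀ x y → adj x y ≡ adj y x
    irrefl : ∀ x → adj x x ≡ false
open Graph public

RThin : ∀ {V} → Graph V → Set
RThin {V} G = ∀ (x y : V) → (∀ z → adj G x z ≡ adj G y z) → x ≡ y

NoK2Component : ∀ {V} → Graph V → Set
NoK2Component {V} G = ∀ (x y : V) → adj G x y ≡ true →
  (∀ z → adj G x z ≡ true → z ≡ y) → (∀ z → adj G y z ≡ true → z ≡ x) → ⊥

record Aut {V : Set} (G : Graph V) : Set where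
  field
    σ       : V → V
    σ⁻¹     : V → V
    invˡ    : ∀ x → σ⁻¹ (σ x) ≡ x
    invʳ    : ∀ x → σ (σ⁻¹ x) ≡ x
    preserv : ∀ x y → adj G (σ x) (σ y) ≡ adj G x y
open Aut public

-- An edge labeling with labels {1,…,d} (represented by Fin d).  Only the values
-- on edges matter; the value on an edge must not depend on orientation.
record EdgeLabeling {V : Set} (G : Graph V) (d : ℕ) : Set where
  field
    lab    : V → V → Fin d
    labSym : ∀ x y → adj G x y ≡ true → lab x y ≡ lab y x
open EdgeLabeling public

Distinguishing : ∀ {V} {G : Graph V} {d} → EdgeLabeling G d → Set
Distinguishing {V} {G} ψ = ∀ (φ : Aut G) →
  (∀ x y → adj G x y ≡ true → lab ψ (σ φ x) (σ φ y) ≡ lab ψ x y) →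
  ∀ x → σ φ x ≡ x

HasDistLabeling : ∀ {V} → Graph V → ℕ → Set
HasDistLabeling G d = Σ (EdgeLabeling G d) Distinguishing

IsDistIndex : ∀ {V} → Graph V → ℕ → Set
IsDistIndex G d = HasDistLabeling G d × (∀ k → k < d → ¬ HasDistLabeling G k)

data MV (n : ℕ) : Set where
  v : Fin n → MV n
  u : Fin n → MV n
  w : MV n

mycAdj : ∀ {n} → Graph (Fin n) → MV n → MV n → Bool
mycAdj G (v i) (v j) = adj G i j
mycAdj G (v i) (u j) = adj G i j
mycAdj G (u i) (v j) = adj G i j
mycAdj G (u i) (u j) = false
mycAdj G (u i) w     = true
mycAdj G w     (u j) = true
mycAdj G (v i) w     = false
mycAdj G w     (v j) = false
mycAdj G w     w     = false

mycSym : ∀ {n} (G : Graph (Fin n)) x y → mycAdj G x y ≡ mycAdj G y x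
mycSym G (v i) (v j) = sym G i j
mycSym G (v i) (u j) = sym G i j
mycSym G (u i) (v j) = sym G i j
mycSym G (u i) (u j) = _≡_.refl
mycSym G (u i) w     = _≡_.refl
mycSym G w     (u j) = _≡_.refl
mycSym G (v i) w     = _≡_.refl
mycSym G w     (v j) = _≡_.refl
mycSym G w     w     = _≡_.refl

mycIrr : ∀ {n} (G : Graph (Fin n)) x → mycAdj G x x ≡ false
mycIrr G (v i) = irrefl G i
mycIrr G (u i) = _≡_.refl
mycIrr G w     = _≡_.refl

μ : ∀ {n} → Graph (Fin n) → Graph (MV n)
μ G = record { adj = mycAdj G ; sym = mycSym G ; irrefl = mycIrr G }

module Submission where

-- Let ψ be a distinguishing d-labeling of G.  Extend it to μ(G)
-- with one extra label: the edges inside the copy of G and the edges u_i v_j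
-- keep their ψ-label (shifted up by one), and the edges w u_i get the new
-- label 0.  Let φ be an automorphism of μ(G) preserving these labels.
--   1. Only the edges at w carry label 0, and w has at least two distinct
--      neighbours u_a, u_b; hence φ(w) = w.
--   2. An automorphism fixing w permutes the neighbours of w (the u_i) and the
--      other vertices (the v_i); its action on the v-copy is an automorphism
--      of G, which preserves ψ, so it is the identity.
--   3. If φ fixes every v_i and φ(u_k) = u_j, then k and j have the same open
--      neighbourhood in G, so k = j because G is R-thin.
-- Thus the labeling is distinguishing and D'(μ(G)) ≤ D'(G) + 1.  The argument
-- only uses that G has two distinct vertices.

open import Defs
open import Data.Nat using (ℕ; suc; _≤_; s≤s)
open import Data.Fin using (Fin; zero; suc)
open import Data.Fin.Properties using (suc-injective)
open import Data.Bool using (true; false)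
open import Data.Product using (Σ; _,_; proj₁; proj₂)
open import Data.Sum using (_⊎_; inj₁; inj₂)
open import Data.Empty using (⊥-elim)
open import Relation.Nullary using (¬_)
open import Relation.Binary.PropositionalEquality
  using (_≡_; refl; trans; cong; cong₂; subst; module ≡-Reasoning)
  renaming (sym to ≡-sym)

σ-injective : ∀ {V} {H : Graph V} (φ : Aut H) {x y : V} → σ φ x ≡ σ φ y → x ≡ y
σ-injective φ {x} {y} e = begin
  x                  ≡⟨ ≡-sym (invˡ φ x) ⟩
  σ⁻¹ φ (σ φ x)      ≡⟨ cong (σ⁻¹ φ) e ⟩
  σ⁻¹ φ (σ φ y)      ≡⟨ invˡ φ y ⟩
  y                  ∎
  where open ≡-Reasoning

inverse : ∀ {V} {H : Graph V} → Aut H → Aut H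
inverse {H = H} φ = record
  { σ = σ⁻¹ φ ; σ⁻¹ = σ φ ; invˡ = invʳ φ ; invʳ = invˡ φ
  ; preserv = λ x y → begin
      adj H (σ⁻¹ φ x) (σ⁻¹ φ y)                  ≡⟨ ≡-sym (preserv φ (σ⁻¹ φ x) (σ⁻¹ φ y)) ⟩
      adj H (σ φ (σ⁻¹ φ x)) (σ φ (σ⁻¹ φ y))      ≡⟨ cong₂ (adj H) (invʳ φ x) (invʳ φ y) ⟩
      adj H x y                                  ∎ }
  where open ≡-Reasoning

inverse-fixes : ∀ {V} {H : Graph V} (φ : Aut H) {x : V} → σ φ x ≡ x → σ⁻¹ φ x ≡ x
inverse-fixes φ {x} e = trans (cong (σ⁻¹ φ) (≡-sym e)) (invˡ φ x)

module _ {n : ℕ} (G : Graph (Fin n)) where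

  neighbour-of-w : ∀ x → mycAdj G w x ≡ true → Σ (Fin n) λ j → x ≡ u j
  neighbour-of-w (u j) _ = j , refl
  neighbour-of-w (v j) ()
  neighbour-of-w w     ()

  non-neighbour-of-w : ∀ x → mycAdj G w x ≡ false → ¬ x ≡ w → Σ (Fin n) λ j → x ≡ v j
  non-neighbour-of-w (v j) _ _    = j , refl
  non-neighbour-of-w (u j) () _
  non-neighbour-of-w w     _  x≢w = ⊥-elim (x≢w refl)

  v-injective : ∀ {i j : Fin n} → v i ≡ v j → i ≡ j
  v-injective refl = refl

  v-image : (φ : Aut (μ G)) → σ φ w ≡ w → ∀ i → Σ (Fin n) λ j → σ φ (v i) ≡ v j
  v-image φ φw i = non-neighbour-of-w (σ φ (v i)) not-adjacent not-w
    where
      not-adjacent : mycAdj G w (σ φ (v i)) ≡ false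
      not-adjacent = subst (λ c → mycAdj G c (σ φ (v i)) ≡ false) φw (preserv φ w (v i))
      not-w : ¬ σ φ (v i) ≡ w
      not-w e with σ-injective φ (trans e (≡-sym φw))
      ... | ()

  u-image : (φ : Aut (μ G)) → σ φ w ≡ w → ∀ k → Σ (Fin n) λ j → σ φ (u k) ≡ u j
  u-image φ φw k = neighbour-of-w (σ φ (u k))
    (subst (λ c → mycAdj G c (σ φ (u k)) ≡ true) φw (preserv φ w (u k)))

  restrict : (φ : Aut (μ G)) → σ φ w ≡ w → Aut G
  restrict φ φw = record
    { σ = f ; σ⁻¹ = f⁻¹
    ; invˡ = λ i → v-injective (begin
        v (f⁻¹ (f i))          ≡⟨ ≡-sym (f⁻¹-spec (f i)) ⟩
        σ⁻¹ φ (v (f i))        ≡⟨ cong (σ⁻¹ φ) (≡-sym (f-spec i)) ⟩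
        σ⁻¹ φ (σ φ (v i))      ≡⟨ invˡ φ (v i) ⟩
        v i                    ∎)
    ; invʳ = λ i → v-injective (begin
        v (f (f⁻¹ i))          ≡⟨ ≡-sym (f-spec (f⁻¹ i)) ⟩
        σ φ (v (f⁻¹ i))        ≡⟨ cong (σ φ) (≡-sym (f⁻¹-spec i)) ⟩
        σ φ (σ⁻¹ φ (v i))      ≡⟨ invʳ φ (v i) ⟩
        v i                    ∎)
    ; preserv = λ i j → trans (≡-sym (cong₂ (mycAdj G) (f-spec i) (f-spec j)))
                              (preserv φ (v i) (v j))
    }
    where
      open ≡-Reasoning
      f f⁻¹ : Fin n → Fin n
      f i = proj₁ (v-image φ φw i)
      f⁻¹ i = proj₁ (v-image (inverse φ) (inverse-fixes φ φw) i)
      f-spec : ∀ i → σ φ (v i) ≡ v (f i)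
      f-spec i = proj₂ (v-image φ φw i)
      f⁻¹-spec : ∀ i → σ⁻¹ φ (v i) ≡ v (f⁻¹ i)
      f⁻¹-spec i = proj₂ (v-image (inverse φ) (inverse-fixes φ φw) i)

  restrict-spec : (φ : Aut (μ G)) (φw : σ φ w ≡ w) →
                  ∀ i → σ φ (v i) ≡ v (σ (restrict φ φw) i)
  restrict-spec φ φw i = proj₂ (v-image φ φw i)

  -- The twin argument: u_k has the same neighbours among the v_i as k has in
  -- G.  So if φ fixes w and every v_i, then φ(u_k) = u_j forces N(j) = N(k),
  -- and j = k when G is R-thin.
  thin-fixes-u : RThin G → (φ : Aut (μ G)) (φw : σ φ w ≡ w) →
                 (∀ i → σ φ (v i) ≡ v i) → ∀ k → σ φ (u k) ≡ u k
  thin-fixes-u thin φ φw φv k = trans image (cong u same-vertex)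
    where
      j : Fin n
      j = proj₁ (u-image φ φw k)
      image : σ φ (u k) ≡ u j
      image = proj₂ (u-image φ φw k)
      same-vertex : j ≡ k
      same-vertex = thin j k λ z →
        trans (≡-sym (cong₂ (mycAdj G) image (φv z))) (preserv φ (u k) (v z))

  module _ {d : ℕ} (ψ : EdgeLabeling G d) where

    extLab : MV n → MV n → Fin (suc d)
    extLab (v i) (v j) = suc (lab ψ i j)
    extLab (v i) (u j) = suc (lab ψ i j)
    extLab (u i) (v j) = suc (lab ψ i j)
    extLab _     _     = zero

    extLab-sym : ∀ x y → mycAdj G x y ≡ true → extLab x y ≡ extLab y x
    extLab-sym (v i) (v j) e = cong suc (labSym ψ i j e)
    extLab-sym (v i) (u j) e = cong suc (labSym ψ i j e)
    extLab-sym (u i) (v j) e = cong suc (labSym ψ i j e)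
    extLab-sym (u i) (u j) ()
    extLab-sym (u i) w     _ = refl
    extLab-sym w     (u j) _ = refl
    extLab-sym (v i) w     ()
    extLab-sym w     (v j) ()
    extLab-sym w     w     ()

    extend : EdgeLabeling (μ G) (suc d)
    extend = record { lab = extLab ; labSym = extLab-sym }

    zero-label-at-w : ∀ x y → mycAdj G x y ≡ true → extLab x y ≡ zero → (x ≡ w) ⊎ (y ≡ w)
    zero-label-at-w (v i) (v j) _ ()
    zero-label-at-w (v i) (u j) _ ()
    zero-label-at-w (u i) (v j) _ ()
    zero-label-at-w (u i) (u j) () _
    zero-label-at-w (u i) w     _ _ = inj₂ refl
    zero-label-at-w (v i) w     () _
    zero-label-at-w w     y     _ _ = inj₁ refl

    PreservesExt : Aut (μ G) → Set
    PreservesExt φ = ∀ x y → mycAdj G x y ≡ true → extLab (σ φ x) (σ φ y) ≡ extLab x y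

    -- Step 1: a label-preserving automorphism fixes w.  Otherwise the 0-labelled
    -- edges w u_a and w u_b would both be mapped to edges at w, forcing
    -- φ(u_a) = w = φ(u_b) with u_a ≠ u_b.
    fixes-w : (a b : Fin n) → ¬ a ≡ b → (φ : Aut (μ G)) → PreservesExt φ → σ φ w ≡ w
    fixes-w a b a≢b φ pres with at-w a | at-w b
      where
        at-w : ∀ k → (σ φ w ≡ w) ⊎ (σ φ (u k) ≡ w)
        at-w k = zero-label-at-w (σ φ w) (σ φ (u k)) (preserv φ w (u k)) (pres w (u k) refl)
    ... | inj₁ φw | _      = φw
    ... | inj₂ _  | inj₁ φw = φw
    ... | inj₂ φa | inj₂ φb with σ-injective φ (trans φa (≡-sym φb))
    ...   | refl = ⊥-elim (a≢b refl)

    restrict-preserves : (φ : Aut (μ G)) (φw : σ φ w ≡ w) → PreservesExt φ →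
      ∀ i j → adj G i j ≡ true →
      lab ψ (σ (restrict φ φw) i) (σ (restrict φ φw) j) ≡ lab ψ i j
    restrict-preserves φ φw pres i j e = suc-injective
      (trans (≡-sym (cong₂ extLab (restrict-spec φ φw i) (restrict-spec φ φw j)))
             (pres (v i) (v j) e))

    extend-distinguishing : RThin G → (a b : Fin n) → ¬ a ≡ b →
                            Distinguishing ψ → Distinguishing extend
    extend-distinguishing thin a b a≢b dist φ pres = fixed
      where
        φw : σ φ w ≡ w
        φw = fixes-w a b a≢b φ pres
        φv : ∀ i → σ φ (v i) ≡ v i
        φv i = trans (restrict-spec φ φw i)
                     (cong v (dist (restrict φ φw) (restrict-preserves φ φw pres) i))
        fixed : ∀ x → σ φ x ≡ x
        fixed (v i) = φv i
        fixed (u k) = thin-fixes-u thin φ φw φv k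
        fixed w     = φw

mainTheorem13 : (n : ℕ) → 3 ≤ n → (G : Graph (Fin n)) → RThin G → NoK2Component G →
    (d : ℕ) → IsDistIndex G d → HasDistLabeling (μ G) (suc d)
mainTheorem13 (suc (suc m)) (s≤s (s≤s _)) G thin _ d ((ψ , dist) , _) =
  extend G ψ , extend-distinguishing G ψ thin zero (suc zero) (λ ()) dist
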